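{- Let $T$ be a tree with eigenvalue $\lambda$. Then the skeleton $S_\lambda(T)$ contains no edge that belongs to every maximum matching of $S_\lambda(T)$.
   Context: Eigenvalues and eigenvectors of a graph are those of its adjacency matrix; an eigenvector for $\lambda$ is a non-zero vector $x$ with $Ax=\lambda x$. For a tree $T$ with eigenvalue $\lambda$: $N(T,x)$ is the set of vertices where eigenvector $x$ vanishes; $N_\lambda(T)$ is the set of vertices where every eigenvector for $\lambda$ vanishes; $N^C(T,x)$ is the set of vertices of $N(T,x)$ adjacent to at least one vertex outside $N(T,x)$; $N^C_\lambda(T)=\bigcup_x N^C(T,x)$ over all eigenvectors $x$ for $\lambda$. Let $C_1,\ldots,C_r$ be the connected components of $T\setminus N_\lambda(T)$ (deletion of $N_\lambda(T)$) and let $T/\{C_i\}_{i=1}^r$ be obtained by contracting each $C_i$ to a single vertex $c_i$. The skeleton $S_\lambda(T)$ is the subgraph of $T/\{C_i\}_{i=1}^r$ induced by $N^C_\lambda(T)\cup\{c_1,\ldots,c_r\}$. -}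

module Defs where

open import Level using (Level; _⊔_) renaming (suc to lsuc)
open import Data.Bool using (Bool; true; false; if_then_else_)
open import Data.Nat using (ℕ; zero; suc; _≤_)
open import Data.Fin using (Fin) renaming (_≤_ to _≤ᶠ_)
open import Data.Product using (Σ; ∃; _×_; _,_; proj₁; proj₂)
open import Data.Sum using (_⊎_)
open import Data.Unit using (⊤)
open import Data.Empty using (⊥)
open import Data.List using (List; []; _∷_; length; _∷ʳ_; concatMap; foldr)
open import Data.List.Relation.Unary.All using (All)
open import Data.List.Relation.Unary.Linked using (Linked)
open import Data.List.Relation.Unary.Unique.Propositional using (Unique)
open import Data.List.Membership.Propositional using (_∈_)
open import Relation.Nullary using (¬_)
open import Relation.Binary.PropositionalEquality using (_≡_)
open import Algebra.Bundles using (CommutativeRing)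

record RealField (c ℓ : Level) : Set (lsuc (c ⊔ ℓ)) where
  field
    commutativeRing : CommutativeRing c ℓ
  open CommutativeRing commutativeRing public
  sumSq : List Carrier → Carrier
  sumSq = foldr (λ a s → a * a + s) 0#
  field
    1≉0          : ¬ (1# ≈ 0#)
    inverse      : ∀ x → ¬ (x ≈ 0#) → ∃ λ y → x * y ≈ 1#
    formallyReal : ∀ (xs : List Carrier) → sumSq xs ≈ 0# → All (λ a → a ≈ 0#) xs

Graph : ℕ → Set
Graph n = Fin n → Fin n → Bool

module _ {n : ℕ} (G : Graph n) where

  Adj : Fin n → Fin n → Set
  Adj u v = G u v ≡ true

  data Reach {p : Level} (P : Fin n → Set p) : Fin n → Fin n → Set p where
    here : ∀ {u} → P u → Reach P u u
    step : ∀ {u w v} → P u → Adj u w → Reach P w v → Reach P u v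

  Symmetric : Set
  Symmetric = ∀ u v → Adj u v → Adj v u

  Irreflexive : Set
  Irreflexive = ∀ u → ¬ Adj u u

  Connected : Set
  Connected = ∀ u v → Reach (λ _ → ⊤) u v

  HasCycle : Set
  HasCycle = Σ (Fin n) λ v → Σ (List (Fin n)) λ vs →
    Unique (v ∷ vs) × 2 ≤ length vs × Linked Adj ((v ∷ vs) ∷ʳ v)

  IsTree : Set
  IsTree = Symmetric × Irreflexive × Connected × ¬ HasCycle

module Spectral {c ℓ : Level} (F : RealField c ℓ) where
  open RealField F

  sumFin : ∀ {m} → (Fin m → Carrier) → Carrier
  sumFin {zero}  f = 0#
  sumFin {suc m} f = f Fin.zero + sumFin (λ i → f (Fin.suc i))

  module _ {n : ℕ} (G : Graph n) (λ₀ : Carrier) where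

    AdjMul : (Fin n → Carrier) → Fin n → Carrier
    AdjMul x v = sumFin (λ u → if G v u then x u else 0#)

    IsEigenvector : (Fin n → Carrier) → Set ℓ
    IsEigenvector x = (∃ λ v → ¬ (x v ≈ 0#)) × (∀ v → AdjMul x v ≈ λ₀ * x v)

    IsEigenvalue : Set (c ⊔ ℓ)
    IsEigenvalue = ∃ λ x → IsEigenvector x

    InN : (Fin n → Carrier) → Fin n → Set ℓ
    InN x v = x v ≈ 0#

    InNλ : Fin n → Set (c ⊔ ℓ)
    InNλ v = ∀ x → IsEigenvector x → InN x v

    InNC : (Fin n → Carrier) → Fin n → Set ℓ
    InNC x v = InN x v × ∃ λ u → Adj G v u × ¬ InN x u

    InNCλ : Fin n → Set (c ⊔ ℓ)
    InNCλ v = ∃ λ x → IsEigenvector x × InNC x v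

    -- v and w are identified in T/{C_i}: equal, or both outside N_λ(T) and in the
    -- same connected component of T ∖ N_λ(T)
    SameClass : Fin n → Fin n → Set (c ⊔ ℓ)
    SameClass v w = v ≡ w ⊎ (¬ InNλ v × Reach G (λ u → ¬ InNλ u) v w)

    -- vertices of the skeleton S_λ(T), each represented by a vertex of T:
    -- a vertex of N^C_λ(T) represents itself; a component C_i of T ∖ N_λ(T)
    -- (i.e. the contracted vertex c_i) is represented by its least vertex
    IsSkelVertex : Fin n → Set (c ⊔ ℓ)
    IsSkelVertex v = InNCλ v ⊎ (¬ InNλ v × (∀ w → SameClass v w → v ≤ᶠ w))

    ContrAdj : Fin n → Fin n → Set (c ⊔ ℓ)
    ContrAdj a b = ¬ SameClass a b ×
      Σ (Fin n) λ u → Σ (Fin n) λ w → SameClass a u × SameClass b w × Adj G u w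

    SkelAdj : Fin n → Fin n → Set (c ⊔ ℓ)
    SkelAdj a b = IsSkelVertex a × IsSkelVertex b × ContrAdj a b

    endpoints : List (Fin n × Fin n) → List (Fin n)
    endpoints = concatMap (λ e → proj₁ e ∷ proj₂ e ∷ [])

    IsSkelMatching : List (Fin n × Fin n) → Set (c ⊔ ℓ)
    IsSkelMatching M = All (λ e → SkelAdj (proj₁ e) (proj₂ e)) M × Unique (endpoints M)

    IsMaxSkelMatching : List (Fin n × Fin n) → Set (c ⊔ ℓ)
    IsMaxSkelMatching M = IsSkelMatching M ×
      (∀ M' → IsSkelMatching M' → length M' ≤ length M)

    EdgeIn : Fin n → Fin n → List (Fin n × Fin n) → Set
    EdgeIn a b M = (a , b) ∈ M ⊎ (b , a) ∈ M

module Submission where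

-- Every vertex v of N^C_λ(T) lies in N_λ(T): if x(v) = 0 ≠ x(u) for a neighbour u, then x
-- restricted to the branch of T ∖ v through u is an eigenvector up to a multiple of δᵥ, and the
-- symmetry of the adjacency matrix forces y(v) = 0 for every eigenvector y.  So two contracted
-- components are never adjacent, and N^C_λ(T) is a vertex cover of the skeleton.
-- Root T at r.  Since (Ax)(v) = λ x(v) = 0 and at most one neighbour of v lies towards r, some
-- child of v has x ≠ 0, hence lies outside N_λ(T); matching each v ∈ N^C_λ(T) with the
-- component of such a child gives a matching as large as the cover, hence a maximum one, whose
-- edges all run from N^C_λ(T) to a component not containing r.  With r = a if b ∈ N^C_λ(T) and
-- r = b otherwise, it misses {a, b}.
-- As N_λ(T) and the components are not decidable over an abstract field, the argument runs in
-- the double-negation monad, which suffices for a negative conclusion.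

open import Defs
open import Level using (_⊔_)
open import Function using (_∘_)
open import Algebra.Bundles using (CommutativeRing)
open import Data.Bool using (true; false; if_then_else_)
open import Data.Nat using (ℕ; zero; suc; _≤_; z≤n; s≤s)
open import Data.Fin using (Fin; zero; suc) renaming (_≟_ to _≟ᶠ_; _≤_ to _≤ᶠ_)
open import Data.Vec.Functional using (Vector)
open import Data.Product using (Σ; ∃; _×_; _,_; proj₁; proj₂)
open import Data.Sum as Sum using (_⊎_; inj₁; inj₂; [_,_]′)
open import Data.Unit using (⊤)
open import Data.Empty using (⊥-elim)
open import Data.List using (List; []; _∷_; length; _∷ʳ_; concatMap; map; filter; allFin)
open import Data.List.Properties using (length-removeAt′; length-map)
open import Data.List.Relation.Unary.All as All using (All; []; _∷_)
open import Data.List.Relation.Unary.All.Properties using (map⁺)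
open import Data.List.Relation.Unary.All.Properties.Core using (¬Any⇒All¬)
open import Data.List.Relation.Unary.Any using (here; there; index)
open import Data.List.Relation.Unary.AllPairs using ([]; _∷_)
open import Data.List.Relation.Unary.Linked using (Linked; [-]; _∷_)
open import Data.List.Relation.Unary.Unique.Propositional using (Unique)
open import Data.List.Relation.Unary.Unique.Propositional.Properties using (allFin⁺; filter⁺)
open import Data.List.Membership.Propositional using (_∈_; _─_)
open import Data.List.Membership.Propositional.Properties
  using (∈-filter⁺; ∈-filter⁻; ∈-allFin; ∈-map⁻)
open import Relation.Nullary using (¬_; Dec; yes; no; does)
open import Relation.Nullary.Decidable using (¬¬-excluded-middle)
open import Relation.Nullary.Negation using (¬¬-map)
open import Relation.Binary.PropositionalEquality as ≡ using (_≡_; _≢_)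

¬¬-∀-Fin : ∀ {p m} {Q : Fin m → Set p} → (∀ i → ¬ ¬ Q i) → ¬ ¬ (∀ i → Q i)
¬¬-∀-Fin {m = zero}      _ k = k (λ ())
¬¬-∀-Fin {m = suc m} {Q} h k =
  h zero λ q₀ → ¬¬-∀-Fin {Q = Q ∘ suc} (h ∘ suc) λ qs → k λ { zero → q₀ ; (suc i) → qs i }

¬¬-decidable-Fin : ∀ {p m} (Q : Fin m → Set p) → ¬ ¬ (∀ i → Dec (Q i))
¬¬-decidable-Fin Q = ¬¬-∀-Fin (λ _ → ¬¬-excluded-middle)

¬¬-→ : ∀ {p q} {A : Set p} {B : Set q} → (A → ¬ ¬ B) → ¬ ¬ (A → B)
¬¬-→ f k = k (λ a → ⊥-elim (f a (λ b → k (λ _ → b))))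

least-witness : ∀ {p m} {Q : Fin m → Set p} → (∀ i → Dec (Q i)) → ∀ u → Q u →
  Σ (Fin m) λ w → Q w × (∀ w′ → Q w′ → w ≤ᶠ w′)
least-witness {m = suc m} {Q} Q? u qu with Q? zero
... | yes q₀ = zero , q₀ , λ _ _ → z≤n
... | no ¬q₀ with u
...   | zero  = ⊥-elim (¬q₀ qu)
...   | suc u′ with least-witness {Q = Q ∘ suc} (Q? ∘ suc) u′ qu
...     | w , qw , w-least = suc w , qw , suc-least
  where
  suc-least : ∀ w′ → Q w′ → suc w ≤ᶠ w′
  suc-least zero     q = ⊥-elim (¬q₀ q)
  suc-least (suc w′) q = s≤s (w-least w′ q)

module Walks {n : ℕ} (G : Graph n) where
  open ≡ using (refl; sym)
  open import Data.List.Membership.DecPropositional (_≟ᶠ_ {n}) using (_∈?_)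

  Symmetric⇒flip≡ : Symmetric G → ∀ u v → G u v ≡ G v u
  Symmetric⇒flip≡ s u v with G u v in uv | G v u in vu
  ... | true  | true  = refl
  ... | false | false = refl
  ... | true  | false = ≡.trans (sym (s u v uv)) vu
  ... | false | true  = ≡.trans (sym uv) (s v u vu)

  module _ {p} {P : Fin n → Set p} where
    reach-start : ∀ {u v} → Reach G P u v → P u
    reach-start (here pu)     = pu
    reach-start (step pu _ _) = pu

    reach-end : ∀ {u v} → Reach G P u v → P v
    reach-end (here pv)    = pv
    reach-end (step _ _ r) = reach-end r

    reach-trans : ∀ {u w v} → Reach G P u w → Reach G P w v → Reach G P u v
    reach-trans (here _)      r′ = r′
    reach-trans (step pu a r) r′ = step pu a (reach-trans r r′)

    reach-snoc : ∀ {u w v} → Reach G P u w → Adj G w v → P v → Reach G P u v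
    reach-snoc r a pv = reach-trans r (step (reach-end r) a (here pv))

    reach-sym : Symmetric G → ∀ {u v} → Reach G P u v → Reach G P v u
    reach-sym s (here pu)             = here pu
    reach-sym s (step {u} {w} pu a r) = reach-snoc (reach-sym s r) (s u w a) pu

  reach-map : ∀ {p q} {P : Fin n → Set p} {Q : Fin n → Set q} →
    (∀ {z} → P z → Q z) → ∀ {u v} → Reach G P u v → Reach G Q u v
  reach-map f (here pu)     = here (f pu)
  reach-map f (step pu a r) = step (f pu) a (reach-map f r)

  data Path : Fin n → Fin n → Set where
    []  : ∀ {u} → Path u u
    _∷_ : ∀ {u w t} → Adj G u w → Path w t → Path u t

  vertices : ∀ {u t} → Path u t → List (Fin n)
  vertices {u} []      = u ∷ []
  vertices {u} (_ ∷ q) = u ∷ vertices q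

  SimplePath : ∀ {p} → (Fin n → Set p) → Fin n → Fin n → Set p
  SimplePath P u t = Σ (Path u t) λ q → Unique (vertices q) × All P (vertices q)

  module _ {p} {P : Fin n → Set p} where
    suffix : ∀ {u w t} (q : Path w t) → u ∈ vertices q → Unique (vertices q) →
             All P (vertices q) → SimplePath P u t
    suffix []      (here refl) U A             = [] , U , A
    suffix (a ∷ q) (here refl) U A             = a ∷ q , U , A
    suffix (a ∷ q) (there m)   (_ ∷ U) (_ ∷ A) = suffix q m U A

    reach⇒simplePath : ∀ {u t} → Reach G P u t → SimplePath P u t
    reach⇒simplePath (here pu) = [] , [] ∷ [] , pu ∷ []
    reach⇒simplePath {u} (step pu a r) with reach⇒simplePath r
    ... | q , U , A with u ∈? vertices q
    ...   | yes m = suffix q m U A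
    ...   | no ¬m = a ∷ q , ¬Any⇒All¬ _ ¬m ∷ U , pu ∷ A

  vertices-length : ∀ {u t} (q : Path u t) → u ≢ t → 2 ≤ length (vertices q)
  vertices-length []          u≢u = ⊥-elim (u≢u refl)
  vertices-length (_ ∷ [])    _   = s≤s (s≤s z≤n)
  vertices-length (_ ∷ _ ∷ _) _   = s≤s (s≤s z≤n)

  linked-around : ∀ {v u t x} → Adj G v u → (q : Path u t) → Adj G t x →
                  Linked (Adj G) (v ∷ (vertices q ∷ʳ x))
  linked-around vu []      tx = vu ∷ tx ∷ [-]
  linked-around vu (a ∷ q) tx = vu ∷ linked-around a q tx

  tree-branches-disjoint : IsTree G → ∀ {v u₁ u₂} → Adj G v u₁ → Adj G v u₂ → u₁ ≢ u₂ →
    ¬ Reach G (_≢ v) u₁ u₂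
  tree-branches-disjoint (s , _ , _ , acyclic) {v} vu₁ vu₂ u₁≢u₂ r with reach⇒simplePath r
  ... | q , U , avoid = acyclic (v , vertices q , All.map (λ z≢v → z≢v ∘ sym) avoid ∷ U ,
                                 vertices-length q u₁≢u₂ , linked-around vu₁ q (s _ _ vu₂))

  walk-after-last-visit : ∀ {s r} (p q : Fin n) → p ≢ q → Reach G (λ _ → ⊤) s r →
    Reach G (λ z → z ≢ p × z ≢ q) s r ⊎ (Reach G (_≢ q) p r ⊎ Reach G (_≢ p) q r)
  walk-after-last-visit {s} p q p≢q (here _) with s ≟ᶠ p | s ≟ᶠ q
  ... | yes refl | _        = inj₂ (inj₁ (here p≢q))
  ... | no _     | yes refl = inj₂ (inj₂ (here (p≢q ∘ sym)))
  ... | no s≢p   | no s≢q   = inj₁ (here (s≢p , s≢q))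
  walk-after-last-visit {s} p q p≢q (step _ a r) with walk-after-last-visit p q p≢q r
  ... | inj₂ tail = inj₂ tail
  ... | inj₁ r′ with s ≟ᶠ p | s ≟ᶠ q
  ...   | yes refl | _        = inj₂ (inj₁ (step p≢q a (reach-map proj₂ r′)))
  ...   | no _     | yes refl = inj₂ (inj₂ (step (p≢q ∘ sym) a (reach-map proj₁ r′)))
  ...   | no s≢p   | no s≢q   = inj₁ (step (s≢p , s≢q) a r′)

module _ {a} {A : Set a} where
  open ≡ using (refl; sym)

  -- Defs' `Spectral.endpoints`, for an arbitrary vertex type
  ends : List (A × A) → List A
  ends = concatMap (λ e → proj₁ e ∷ proj₂ e ∷ [])

  ∈-─⁺ : ∀ {x y} {C : List A} (x∈C : x ∈ C) → y ∈ C → x ≢ y → y ∈ C ─ x∈C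
  ∈-─⁺ (here refl) (here refl) x≢x = ⊥-elim (x≢x refl)
  ∈-─⁺ (here refl) (there y∈C) _   = y∈C
  ∈-─⁺ (there _)   (here y≡z)  _   = here y≡z
  ∈-─⁺ (there x∈C) (there y∈C) x≢y = there (∈-─⁺ x∈C y∈C x≢y)

  Covers : List A → A × A → Set a
  Covers C (p , q) = p ∈ C ⊎ q ∈ C

  covers-─ : ∀ {x C} (x∈C : x ∈ C) M → All (x ≢_) (ends M) →
             All (Covers C) M → All (Covers (C ─ x∈C)) M
  covers-─ x∈C []      _                  []       = []
  covers-─ x∈C (_ ∷ M) (x≢p ∷ x≢q ∷ x∉M) (c ∷ cs) =
    Sum.map (λ p∈C → ∈-─⁺ x∈C p∈C x≢p) (λ q∈C → ∈-─⁺ x∈C q∈C x≢q) c ∷ covers-─ x∈C M x∉M cs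

  matching-length≤cover : ∀ C M → Unique (ends M) → All (Covers C) M → length M ≤ length C
  matching-length≤cover C []      _                     []           = z≤n
  matching-length≤cover C (_ ∷ M) ((_ ∷ p∉M) ∷ q∉M ∷ U) (cover ∷ cs) =
    [ remove p∉M , remove q∉M ]′ cover
    where
    remove : ∀ {x} → All (x ≢_) (ends M) → x ∈ C → suc (length M) ≤ length C
    remove x∉M x∈C = ≡.subst (_ ≤_) (sym (length-removeAt′ C (index x∈C)))
      (s≤s (matching-length≤cover (C ─ x∈C) M U (covers-─ x∈C M x∉M cs)))

  ends-map-All : ∀ {p} {P : A → Set p} (f : A → A) xs → All (λ x → P x × P (f x)) xs →
                 All P (ends (map (λ x → x , f x) xs))
  ends-map-All f []       []                = []
  ends-map-All f (_ ∷ xs) ((px , pfx) ∷ ps) = px ∷ pfx ∷ ends-map-All f xs ps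

  map-ends-unique : (f : A → A) (xs : List A) → Unique xs →
    (∀ {x y} → x ∈ xs → y ∈ xs → f x ≡ f y → x ≡ y) →
    (∀ {x y} → x ∈ xs → y ∈ xs → x ≢ f y) →
    Unique (ends (map (λ x → x , f x) xs))
  map-ends-unique f []       _          _   _   = []
  map-ends-unique f (x ∷ xs) (x∉ ∷ U) inj out =
    (out (here refl) (here refl) ∷ ends-map-All f xs (All.tabulate x≢)) ∷
    ends-map-All f xs (All.tabulate fx≢) ∷
    map-ends-unique f xs U (λ y∈ z∈ → inj (there y∈) (there z∈))
                           (λ y∈ z∈ → out (there y∈) (there z∈))
    where
    x≢ : ∀ {y} → y ∈ xs → x ≢ y × x ≢ f y
    x≢ y∈ = All.lookup x∉ y∈ , out (here refl) (there y∈)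
    fx≢ : ∀ {y} → y ∈ xs → f x ≢ y × f x ≢ f y
    fx≢ y∈ = (λ fx≡y → out (there y∈) (here refl) (sym fx≡y)) ,
             (λ fx≡fy → All.lookup x∉ y∈ (inj (here refl) (there y∈) fx≡fy))

module AdjacencyForm {c ℓ} (R : CommutativeRing c ℓ) where
  open CommutativeRing R hiding (zero)
  open import Algebra.Properties.Semiring.Sum semiring public
    using (sum; sum-cong-≋; ∑-distrib-+)
  open import Algebra.Properties.Semiring.Sum semiring
    using (sum-replicate-zero; ∑-comm; *-distribˡ-sum)
  open import Data.Fin.Properties using (suc-injective)
  open import Relation.Binary.Reasoning.Setoid setoid

  sum-zero : ∀ {m} {f : Vector Carrier m} → (∀ i → f i ≈ 0#) → sum f ≈ 0#
  sum-zero {m} f≈0 = trans (sum-cong-≋ f≈0) (sum-replicate-zero m)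

  sum-single : ∀ {m} {f : Vector Carrier m} k → (∀ i → i ≢ k → f i ≈ 0#) → sum f ≈ f k
  sum-single {suc m} {f} zero    f≈0 =
    trans (+-congˡ (sum-zero (λ i → f≈0 (suc i) λ ()))) (+-identityʳ (f zero))
  sum-single {suc m} {f} (suc k) f≈0 =
    trans (+-congʳ (f≈0 zero λ ()))
      (trans (+-identityˡ _) (sum-single k (λ i i≢k → f≈0 (suc i) (i≢k ∘ suc-injective))))

  adjMul : ∀ {n} → Graph n → Vector Carrier n → Vector Carrier n
  adjMul G x w = sum (λ z → if G w z then x z else 0#)

  ⟨_,_⟩ : ∀ {n} → Vector Carrier n → Vector Carrier n → Carrier
  ⟨ x , y ⟩ = sum (λ w → x w * y w)

  *-if : ∀ b y a → y * (if b then a else 0#) ≈ (if b then y * a else 0#)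
  *-if true  y a = refl
  *-if false y a = zeroʳ y

  module _ {n} (G : Graph n) where

    ⟨,adjMul⟩≈∑∑ : ∀ x y →
      ⟨ y , adjMul G x ⟩ ≈ sum (λ w → sum (λ z → if G w z then y w * x z else 0#))
    ⟨,adjMul⟩≈∑∑ x y =
      sum-cong-≋ λ w → trans (*-distribˡ-sum (y w) (λ z → if G w z then x z else 0#))
                             (sum-cong-≋ {n} λ z → *-if (G w z) (y w) (x z))

    adjMul-selfAdjoint : (∀ u v → G u v ≡ G v u) → ∀ x y → ⟨ y , adjMul G x ⟩ ≈ ⟨ x , adjMul G y ⟩
    adjMul-selfAdjoint G-sym x y = begin
      ⟨ y , adjMul G x ⟩
        ≈⟨ ⟨,adjMul⟩≈∑∑ x y ⟩
      sum (λ w → sum (λ z → if G w z then y w * x z else 0#))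
        ≈⟨ ∑-comm (λ w z → if G w z then y w * x z else 0#) ⟩
      sum (λ z → sum (λ w → if G w z then y w * x z else 0#))
        ≈⟨ sum-cong-≋ (λ z → sum-cong-≋ (transpose z)) ⟩
      sum (λ z → sum (λ w → if G z w then x z * y w else 0#))
        ≈⟨ ⟨,adjMul⟩≈∑∑ y x ⟨
      ⟨ x , adjMul G y ⟩
        ∎
      where
      transpose : ∀ z w → (if G w z then y w * x z else 0#) ≈ (if G z w then x z * y w else 0#)
      transpose z w rewrite G-sym w z with G z w
      ... | true  = *-comm (y w) (x z)
      ... | false = refl

module FieldProperties {c ℓ} (F : RealField c ℓ) where
  open RealField F
  open import Relation.Binary.Reasoning.Setoid setoid

  x*y≈0⇒x≈0 : ∀ {x y} → ¬ y ≈ 0# → x * y ≈ 0# → x ≈ 0#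
  x*y≈0⇒x≈0 {x} {y} y≉0 xy≈0 with inverse y y≉0
  ... | y⁻¹ , yy⁻¹≈1 = begin
    x                ≈⟨ *-identityʳ x ⟨
    x * 1#           ≈⟨ *-congˡ yy⁻¹≈1 ⟨
    x * (y * y⁻¹)    ≈⟨ *-assoc x y y⁻¹ ⟨
    (x * y) * y⁻¹    ≈⟨ *-congʳ xy≈0 ⟩
    0# * y⁻¹         ≈⟨ zeroˡ y⁻¹ ⟩
    0#               ∎

module Skeleton {c ℓ} (F : RealField c ℓ) {n : ℕ} (T : Graph n) (tree : IsTree T)
                (λ₀ : RealField.Carrier F) where
  open RealField F hiding (zero)
  open Spectral F
  open Walks T
  open AdjacencyForm commutativeRing
  open FieldProperties F
  open import Algebra.Properties.Ring ring using (+-identityʳ-unique)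
  open import Algebra.Properties.CommutativeSemigroup *-commutativeSemigroup using (x∙yz≈z∙yx)
  open import Relation.Nullary.Decidable using (dec-true; dec-false)
  open import Relation.Binary.Reasoning.Setoid setoid

  private
    T-symmetric : Symmetric T
    T-symmetric = proj₁ tree

    T-irreflexive : Irreflexive T
    T-irreflexive = proj₁ (proj₂ tree)

    T-connected : Connected T
    T-connected = proj₁ (proj₂ (proj₂ tree))

  Nλ : Fin n → Set (c ⊔ ℓ)
  Nλ = InNλ T λ₀

  NCλ : Fin n → Set (c ⊔ ℓ)
  NCλ = InNCλ T λ₀

  _∼_ : Fin n → Fin n → Set (c ⊔ ℓ)
  _∼_ = SameClass T λ₀

  sumFin≡sum : ∀ {m} (f : Vector Carrier m) → sumFin f ≡ sum f
  sumFin≡sum {zero}  f = ≡.refl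
  sumFin≡sum {suc m} f = ≡.cong (f zero +_) (sumFin≡sum (f ∘ suc))

  eigen-equation : ∀ {x} → IsEigenvector T λ₀ x → ∀ w → adjMul T x w ≈ λ₀ * x w
  eigen-equation {x} (_ , Ax≈λx) w =
    trans (reflexive (≡.sym (sumFin≡sum (λ z → if T w z then x z else 0#)))) (Ax≈λx w)

  module Branch {v u} (v~u : Adj T v u) (branch? : ∀ w → Dec (Reach T (_≢ v) u w))
                (x : Vector Carrier n) (x-eigen : IsEigenvector T λ₀ x) (xv≈0 : x v ≈ 0#) where

    restricted : Vector Carrier n
    restricted w = if does (branch? w) then x w else 0#

    xu·δᵥ : Vector Carrier n
    xu·δᵥ w = if does (w ≟ᶠ v) then x u else 0#

    u≢v : u ≢ v
    u≢v ≡.refl = T-irreflexive u v~u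

    restricted-u : restricted u ≈ x u
    restricted-u with branch? u
    ... | yes _   = refl
    ... | no u↛u = ⊥-elim (u↛u (here u≢v))

    row-v-off-u : ∀ z → z ≢ u → (if T v z then restricted z else 0#) ≈ 0#
    row-v-off-u z z≢u with T v z in v~z
    ... | false = refl
    ... | true with branch? z
    ...   | yes u→z = ⊥-elim (tree-branches-disjoint tree v~u v~z (z≢u ∘ ≡.sym) u→z)
    ...   | no _    = refl

    row-in-branch : ∀ {w} → Reach T (_≢ v) u w →
             ∀ z → (if T w z then restricted z else 0#) ≈ (if T w z then x z else 0#)
    row-in-branch {w} u→w z with T w z in w~z
    ... | false = refl
    ... | true with branch? z
    ...   | yes _   = refl
    ...   | no u↛z with z ≟ᶠ v
    ...     | yes ≡.refl = sym xv≈0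
    ...     | no z≢v     = ⊥-elim (u↛z (reach-snoc u→w w~z z≢v))

    row-off-branch : ∀ {w} → ¬ Reach T (_≢ v) u w → w ≢ v →
              ∀ z → (if T w z then restricted z else 0#) ≈ 0#
    row-off-branch {w} u↛w w≢v z with T w z in w~z
    ... | false = refl
    ... | true with branch? z
    ...   | yes u→z = ⊥-elim (u↛w (reach-snoc u→z (T-symmetric w z w~z) w≢v))
    ...   | no _    = refl

    adjMul-restricted : ∀ w → adjMul T restricted w ≈ λ₀ * restricted w + xu·δᵥ w
    adjMul-restricted w with w ≟ᶠ v
    ... | no w≢v with branch? w
    ...   | yes u→w = trans (sum-cong-≋ (row-in-branch u→w))
                        (trans (eigen-equation x-eigen w) (sym (+-identityʳ _)))
    ...   | no u↛w  = trans (sum-zero (row-off-branch u↛w w≢v))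
                        (sym (trans (+-identityʳ _) (zeroʳ λ₀)))
    adjMul-restricted w | yes ≡.refl with branch? w
    ... | yes u→v = ⊥-elim (reach-end u→v ≡.refl)
    ... | no _    = begin
      adjMul T restricted w                  ≈⟨ sum-single u row-v-off-u ⟩
      (if T w u then restricted u else 0#)   ≡⟨ ≡.cong (if_then restricted u else 0#) v~u ⟩
      restricted u                           ≈⟨ restricted-u ⟩
      x u                                    ≈⟨ +-identityˡ (x u) ⟨
      0# + x u                               ≈⟨ +-congʳ (zeroʳ λ₀) ⟨
      λ₀ * 0# + x u                          ∎

    ⟨,xu·δᵥ⟩ : ∀ y → ⟨ y , xu·δᵥ ⟩ ≈ y v * x u
    ⟨,xu·δᵥ⟩ y = trans (sum-single v off-v) (*-congˡ (reflexive at-v))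
      where
      at-v : xu·δᵥ v ≡ x u
      at-v = ≡.cong (if_then x u else 0#) (dec-true (v ≟ᶠ v) ≡.refl)
      off-v : ∀ w → w ≢ v → y w * xu·δᵥ w ≈ 0#
      off-v w w≢v =
        trans (*-congˡ (reflexive (≡.cong (if_then x u else 0#) (dec-false (w ≟ᶠ v) w≢v))))
              (zeroʳ (y w))

    eigenvector-vanishes : ¬ x u ≈ 0# → ∀ y → IsEigenvector T λ₀ y → y v ≈ 0#
    eigenvector-vanishes xu≉0 y y-eigen = x*y≈0⇒x≈0 xu≉0 (+-identityʳ-unique S (y v * x u) S+yx≈S)
      where
      S : Carrier
      S = ⟨ y , (λ w → λ₀ * restricted w) ⟩
      S+yx≈S : S + y v * x u ≈ S
      S+yx≈S = begin
        S + y v * x u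
          ≈⟨ +-congˡ (⟨,xu·δᵥ⟩ y) ⟨
        S + ⟨ y , xu·δᵥ ⟩
          ≈⟨ ∑-distrib-+ (λ w → y w * (λ₀ * restricted w)) (λ w → y w * xu·δᵥ w) ⟨
        sum (λ w → y w * (λ₀ * restricted w) + y w * xu·δᵥ w)
          ≈⟨ sum-cong-≋ (λ w → trans (*-congˡ (adjMul-restricted w)) (distribˡ (y w) _ _)) ⟨
        ⟨ y , adjMul T restricted ⟩
          ≈⟨ adjMul-selfAdjoint T (Symmetric⇒flip≡ T-symmetric) restricted y ⟩
        ⟨ restricted , adjMul T y ⟩
          ≈⟨ sum-cong-≋ (λ w → trans (*-congˡ (eigen-equation y-eigen w)) (x∙yz≈z∙yx _ _ _)) ⟩
        S
          ∎

  NCλ⇒¬¬Nλ : ∀ {v} → NCλ v → ¬ ¬ Nλ v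
  NCλ⇒¬¬Nλ {v} (x , x-eigen , xv≈0 , u , v~u , xu≉0) ¬Nλv =
    ¬¬-decidable-Fin (Reach T (_≢ v) u) λ branch? →
    ¬Nλv (Branch.eigenvector-vanishes v~u branch? x x-eigen xv≈0 xu≉0)

  ∼-sym : ∀ {u w} → u ∼ w → w ∼ u
  ∼-sym (inj₁ ≡.refl)      = inj₁ ≡.refl
  ∼-sym (inj₂ (_ , u→w)) = inj₂ (reach-end u→w , reach-sym T-symmetric u→w)

  ∼-trans : ∀ {u v w} → u ∼ v → v ∼ w → u ∼ w
  ∼-trans (inj₁ ≡.refl)         v∼w                = v∼w
  ∼-trans u∼v@(inj₂ _)        (inj₁ ≡.refl)      = u∼v
  ∼-trans (inj₂ (¬Nλu , u→v)) (inj₂ (_ , v→w)) = inj₂ (¬Nλu , reach-trans u→v v→w)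

  ∼-¬Nλ : ∀ {u w} → u ∼ w → ¬ Nλ u → ¬ Nλ w
  ∼-¬Nλ (inj₁ ≡.refl)    ¬Nλu = ¬Nλu
  ∼-¬Nλ (inj₂ (_ , u→w)) _    = reach-end u→w

  ∼-avoiding : ∀ {u w v} → u ∼ w → ¬ ¬ Nλ v → ¬ Nλ u → Reach T (_≢ v) u w
  ∼-avoiding (inj₁ ≡.refl)    ¬¬Nλv ¬Nλu = here λ { ≡.refl → ¬¬Nλv ¬Nλu }
  ∼-avoiding (inj₂ (_ , u→w)) ¬¬Nλv _    = reach-map (λ { ¬Nλz ≡.refl → ¬¬Nλv ¬Nλz }) u→w

  ¬Nλ⇒¬ContrAdj : ∀ {p q} → ¬ Nλ p → ¬ Nλ q → ¬ ContrAdj T λ₀ p q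
  ¬Nλ⇒¬ContrAdj ¬Nλp ¬Nλq (p≁q , u , w , p∼u , q∼w , u~w) =
    p≁q (∼-trans p∼u (∼-trans u∼w (∼-sym q∼w)))
    where
    ¬Nλu : ¬ Nλ u
    ¬Nλu = ∼-¬Nλ p∼u ¬Nλp
    u∼w : u ∼ w
    u∼w = inj₂ (¬Nλu , step ¬Nλu u~w (here (∼-¬Nλ q∼w ¬Nλq)))

  -- u is a child of v in T rooted at r
  IsChild : Fin n → Fin n → Fin n → Set (c ⊔ ℓ)
  IsChild r v u = Adj T v u × ¬ Nλ u × ¬ Reach T (_≢ v) u r

  child-exists : ∀ r {v} → NCλ v → ¬ ¬ ∃ (IsChild r v)
  child-exists r {v} (x , x-eigen , xv≈0 , u , v~u , xu≉0) no-child =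
    ¬¬-decidable-Fin (λ w → x w ≈ 0#) λ zero? →
    ¬¬-decidable-Fin (λ w → Reach T (_≢ v) w r) λ reaches? →
    xu≉0 (xu≈0 zero? reaches?)
    where
    nonzero⇒¬Nλ : ∀ {w} → ¬ x w ≈ 0# → ¬ Nλ w
    nonzero⇒¬Nλ xw≉0 Nλw = xw≉0 (Nλw x x-eigen)

    xu≈0 : (∀ w → Dec (x w ≈ 0#)) → (∀ w → Dec (Reach T (_≢ v) w r)) → x u ≈ 0#
    xu≈0 zero? reaches? with reaches? u
    ... | no u↛r  = ⊥-elim (no-child (u , v~u , nonzero⇒¬Nλ xu≉0 , u↛r))
    ... | yes u→r = begin
      x u                              ≡⟨ ≡.cong (if_then x u else 0#) v~u ⟨
      (if T v u then x u else 0#)      ≈⟨ sum-single u others-vanish ⟨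
      adjMul T x v                     ≈⟨ eigen-equation x-eigen v ⟩
      λ₀ * x v                         ≈⟨ *-congˡ xv≈0 ⟩
      λ₀ * 0#                          ≈⟨ zeroʳ λ₀ ⟩
      0#                               ∎
      where
      -- a second neighbour reaching r would close a cycle through v
      others-vanish : ∀ w → w ≢ u → (if T v w then x w else 0#) ≈ 0#
      others-vanish w w≢u with T v w in v~w
      ... | false = refl
      ... | true with zero? w
      ...   | yes xw≈0 = xw≈0
      ...   | no xw≉0 with reaches? w
      ...     | no w↛r  = ⊥-elim (no-child (w , v~w , nonzero⇒¬Nλ xw≉0 , w↛r))
      ...     | yes w→r = ⊥-elim (tree-branches-disjoint tree v~u v~w (w≢u ∘ ≡.sym)
                                    (reach-trans u→r (reach-sym T-symmetric w→r)))

  children-separated : ∀ {r v v′ u u′} → v ≢ v′ → NCλ v → NCλ v′ →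
    IsChild r v u → IsChild r v′ u′ → ¬ u ∼ u′
  children-separated {r} {v} {v′} {u} {u′} v≢v′ NCv NCv′
                     (v~u , ¬Nλu , u↛r) (v′~u′ , _ , u′↛r) u∼u′
    with walk-after-last-visit v v′ v≢v′ (T-connected v r)
  ... | inj₁ v→r         = proj₁ (reach-start v→r) ≡.refl
  ... | inj₂ (inj₁ v→r)  = u′↛r (reach-trans u′→v v→r)
    where
    u′→v : Reach T (_≢ v′) u′ v
    u′→v = reach-snoc (reach-sym T-symmetric (∼-avoiding u∼u′ (NCλ⇒¬¬Nλ NCv′) ¬Nλu))
                      (T-symmetric v u v~u) v≢v′
  ... | inj₂ (inj₂ v′→r) = u↛r (reach-trans u→v′ v′→r)
    where
    u→v′ : Reach T (_≢ v) u v′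
    u→v′ = reach-snoc (∼-avoiding u∼u′ (NCλ⇒¬¬Nλ NCv) ¬Nλu)
                      (T-symmetric v′ u′ v′~u′) (v≢v′ ∘ ≡.sym)

  OrientedAwayFrom : Fin n → List (Fin n × Fin n) → Set (c ⊔ ℓ)
  OrientedAwayFrom r M = ∀ {p q} → (p , q) ∈ M → NCλ p × ¬ NCλ q × q ≢ r

  awayFrom-a⇒¬EdgeIn : ∀ {a b M} → OrientedAwayFrom a M → NCλ b → ¬ EdgeIn T λ₀ a b M
  awayFrom-a⇒¬EdgeIn away NCb (inj₁ ab∈M) = proj₁ (proj₂ (away ab∈M)) NCb
  awayFrom-a⇒¬EdgeIn away NCb (inj₂ ba∈M) = proj₂ (proj₂ (away ba∈M)) ≡.refl

  awayFrom-b⇒¬EdgeIn : ∀ {a b M} → OrientedAwayFrom b M → ¬ NCλ b → ¬ EdgeIn T λ₀ a b M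
  awayFrom-b⇒¬EdgeIn away ¬NCb (inj₁ ab∈M) = proj₂ (proj₂ (away ab∈M)) ≡.refl
  awayFrom-b⇒¬EdgeIn away ¬NCb (inj₂ ba∈M) = ¬NCb (proj₁ (away ba∈M))

  module RootedMatching (r : Fin n) (NCλ? : ∀ v → Dec (NCλ v)) (∼? : ∀ v w → Dec (v ∼ w))
                        (child : ∀ v → NCλ v → ∃ (IsChild r v)) where

    least-in-class : ∀ u → Σ (Fin n) λ w → u ∼ w × (∀ w′ → u ∼ w′ → w ≤ᶠ w′)
    least-in-class u = least-witness (∼? u) u (inj₁ ≡.refl)

    rep : Fin n → Fin n
    rep u = proj₁ (least-in-class u)

    ∼-rep : ∀ u → u ∼ rep u
    ∼-rep u = proj₁ (proj₂ (least-in-class u))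

    rep-isSkelVertex : ∀ {u} → ¬ Nλ u → IsSkelVertex T λ₀ (rep u)
    rep-isSkelVertex {u} ¬Nλu = inj₂ (∼-¬Nλ (∼-rep u) ¬Nλu , λ w rep∼w →
      proj₂ (proj₂ (least-in-class u)) w (∼-trans (∼-rep u) rep∼w))

    -- the value v off N^C_λ(T) is junk: partner is only used on the boundary list below
    partner : Fin n → Fin n
    partner v with NCλ? v
    ... | yes NCv = rep (proj₁ (child v NCv))
    ... | no _    = v

    partner-rep-child : ∀ {v} → NCλ v → ∃ λ u → IsChild r v u × partner v ≡ rep u
    partner-rep-child {v} NCv with NCλ? v
    ... | yes NCv′ = proj₁ (child v NCv′) , proj₂ (child v NCv′) , ≡.refl
    ... | no ¬NCv  = ⊥-elim (¬NCv NCv)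

    partner-¬Nλ : ∀ {v} → NCλ v → ¬ Nλ (partner v)
    partner-¬Nλ NCv with partner-rep-child NCv
    ... | u , (_ , ¬Nλu , _) , eq = ≡.subst (λ z → ¬ Nλ z) (≡.sym eq) (∼-¬Nλ (∼-rep u) ¬Nλu)

    partner-isSkelAdj : ∀ {v} → NCλ v → SkelAdj T λ₀ v (partner v)
    partner-isSkelAdj {v} NCv with partner-rep-child NCv
    ... | u , (v~u , ¬Nλu , _) , eq = ≡.subst (SkelAdj T λ₀ v) (≡.sym eq)
      (inj₁ NCv , rep-isSkelVertex ¬Nλu ,
       (λ v∼rep → NCλ⇒¬¬Nλ NCv (∼-¬Nλ (∼-sym v∼rep) (∼-¬Nλ (∼-rep u) ¬Nλu))) ,
       v , u , inj₁ ≡.refl , ∼-sym (∼-rep u) , v~u)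

    partner-≢root : ∀ {v} → NCλ v → partner v ≢ r
    partner-≢root {v} NCv partner≡r with partner-rep-child NCv
    ... | u , (_ , ¬Nλu , u↛r) , eq = u↛r (∼-avoiding u∼r (NCλ⇒¬¬Nλ NCv) ¬Nλu)
      where
      u∼r : u ∼ r
      u∼r = ≡.subst (u ∼_) (≡.trans (≡.sym eq) partner≡r) (∼-rep u)

    partner-injective : ∀ {v v′} → NCλ v → NCλ v′ → partner v ≡ partner v′ → v ≡ v′
    partner-injective {v} {v′} NCv NCv′ eq
      with v ≟ᶠ v′ | partner-rep-child NCv | partner-rep-child NCv′
    ... | yes v≡v′ | _ | _ = v≡v′
    ... | no v≢v′ | u , u-child , eqᵤ | u′ , u′-child , eqᵤ′ =
      ⊥-elim (children-separated v≢v′ NCv NCv′ u-child u′-child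
               (∼-trans (∼-rep u) (≡.subst (_∼ u′) rep≡rep (∼-sym (∼-rep u′)))))
      where
      rep≡rep : rep u′ ≡ rep u
      rep≡rep = ≡.trans (≡.sym eqᵤ′) (≡.trans (≡.sym eq) eqᵤ)

    NCλ≢partner : ∀ {v v′} → NCλ v → NCλ v′ → v ≢ partner v′
    NCλ≢partner NCv NCv′ v≡partner =
      NCλ⇒¬¬Nλ NCv (≡.subst (λ z → ¬ Nλ z) (≡.sym v≡partner) (partner-¬Nλ NCv′))

    boundary : List (Fin n)
    boundary = filter NCλ? (allFin n)

    NCλ⇒∈boundary : ∀ {v} → NCλ v → v ∈ boundary
    NCλ⇒∈boundary NCv = ∈-filter⁺ NCλ? (∈-allFin _) NCv

    ∈boundary⇒NCλ : ∀ {v} → v ∈ boundary → NCλ v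
    ∈boundary⇒NCλ v∈ = proj₂ (∈-filter⁻ NCλ? {xs = allFin n} v∈)

    matching : List (Fin n × Fin n)
    matching = map (λ v → v , partner v) boundary

    matching-isSkelMatching : IsSkelMatching T λ₀ matching
    matching-isSkelMatching =
      map⁺ (All.tabulate (partner-isSkelAdj ∘ ∈boundary⇒NCλ)) ,
      map-ends-unique partner boundary (filter⁺ NCλ? (allFin⁺ n))
        (λ v∈ v′∈ → partner-injective (∈boundary⇒NCλ v∈) (∈boundary⇒NCλ v′∈))
        (λ v∈ v′∈ → NCλ≢partner (∈boundary⇒NCλ v∈) (∈boundary⇒NCλ v′∈))

    skelAdj-covered : ∀ {p q} → SkelAdj T λ₀ p q → Covers boundary (p , q)
    skelAdj-covered {p} {q} (p-skel , q-skel , p~q) with NCλ? p | NCλ? q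
    ... | yes NCp | _       = inj₁ (NCλ⇒∈boundary NCp)
    ... | no _    | yes NCq = inj₂ (NCλ⇒∈boundary NCq)
    ... | no ¬NCp | no ¬NCq =
      ⊥-elim (¬Nλ⇒¬ContrAdj (component-¬Nλ p-skel ¬NCp) (component-¬Nλ q-skel ¬NCq) p~q)
      where
      component-¬Nλ : ∀ {s} → IsSkelVertex T λ₀ s → ¬ NCλ s → ¬ Nλ s
      component-¬Nλ (inj₁ NCs)          ¬NCs = ⊥-elim (¬NCs NCs)
      component-¬Nλ (inj₂ (¬Nλs , _)) _    = ¬Nλs

    matching-isMaxSkelMatching : IsMaxSkelMatching T λ₀ matching
    matching-isMaxSkelMatching = matching-isSkelMatching , λ M (M-edges , M-unique) →
      ≡.subst (length M ≤_) (≡.sym (length-map _ boundary))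
        (matching-length≤cover boundary M M-unique (All.map skelAdj-covered M-edges))

    matching-orientedAwayFrom : OrientedAwayFrom r matching
    matching-orientedAwayFrom pq∈ with ∈-map⁻ (λ v → v , partner v) pq∈
    ... | v , v∈ , ≡.refl =
      NCv , (λ NC-partner → NCλ⇒¬¬Nλ NC-partner (partner-¬Nλ NCv)) , partner-≢root NCv
      where
      NCv : NCλ v
      NCv = ∈boundary⇒NCλ v∈

  module _ (NCλ? : ∀ v → Dec (NCλ v)) (∼? : ∀ v w → Dec (v ∼ w)) where

    oriented-maximum-matching : ∀ r →
      ¬ ¬ ∃ λ M → IsMaxSkelMatching T λ₀ M × OrientedAwayFrom r M
    oriented-maximum-matching r = ¬¬-map rooted (¬¬-∀-Fin λ v → ¬¬-→ (child-exists r))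
      where
      rooted : (∀ v → NCλ v → ∃ (IsChild r v)) →
               ∃ λ M → IsMaxSkelMatching T λ₀ M × OrientedAwayFrom r M
      rooted child = matching , matching-isMaxSkelMatching , matching-orientedAwayFrom
        where open RootedMatching r NCλ? ∼? child

    edge-avoiding-maximum-matching : ∀ a b →
      ¬ ¬ ∃ λ M → IsMaxSkelMatching T λ₀ M × ¬ EdgeIn T λ₀ a b M
    edge-avoiding-maximum-matching a b with NCλ? b
    ... | yes NCb = ¬¬-map (λ (M , M-max , away) → M , M-max , awayFrom-a⇒¬EdgeIn away NCb)
                           (oriented-maximum-matching a)
    ... | no ¬NCb = ¬¬-map (λ (M , M-max , away) → M , M-max , awayFrom-b⇒¬EdgeIn away ¬NCb)
                           (oriented-maximum-matching b)

mainTheorem17 : ∀ {c ℓ} (F : RealField c ℓ) →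
    ∀ (n : ℕ) (T : Graph n) → IsTree T →
    ∀ (λ₀ : RealField.Carrier F) → Spectral.IsEigenvalue F T λ₀ →
    ∀ (a b : Fin n) → Spectral.SkelAdj F T λ₀ a b →
    ¬ (∀ (M : List (Fin n × Fin n)) → Spectral.IsMaxSkelMatching F T λ₀ M → Spectral.EdgeIn F T λ₀ a b M)
mainTheorem17 F n T tree λ₀ _ a b _ inEveryMaximum =
  ¬¬-decidable-Fin NCλ λ NCλ? →
  ¬¬-∀-Fin (λ v → ¬¬-decidable-Fin (v ∼_)) λ ∼? →
  edge-avoiding-maximum-matching NCλ? ∼? a b λ (M , M-maximum , ab∉M) →
  ab∉M (inEveryMaximum M M-maximum)
  where open Skeleton F T tree λ₀
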